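{- Let $k\ge 1$. In the ordered chain game on the $2$-dimensional $k$-wedge $W^2_k$, Walker has a strategy to build a chain of size $\lceil 2k/3\rceil$ using only his first $\lceil 2k/3\rceil$ moves, and Blocker has a strategy preventing Walker from building a chain of size larger than $\lceil 2k/3\rceil$.
   Context: $W^2_k$ is the poset of pairs $(a,b)$ of nonnegative integers with $a+b<k$, ordered coordinatewise. In the ordered chain game (Walker-Blocker game) on a finite poset, Walker and Blocker alternately (Walker first) choose previously unchosen elements until all are chosen. Walker builds a chain of size $m$ if there are elements $x_1\prec\cdots\prec x_m$ all chosen by Walker, chosen in this order in time. -}

module Defs where

open import Data.Nat using (ℕ; zero; suc; _+_; _*_; _≤_; _<_)
open import Data.Nat.DivMod using (_/_)
open import Data.Bool using (Bool; true; false; if_then_else_)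
open import Data.List using (List; []; _∷_; _++_; length; take)
open import Data.List.Membership.Propositional using (_∈_; _∉_)
open import Data.List.Relation.Binary.Sublist.Propositional using (_⊆_)
open import Data.List.Relation.Unary.Linked using (Linked)
open import Data.Product using (Σ; _×_; _,_)
open import Data.Sum using (_⊎_; inj₁; inj₂)
open import Relation.Binary.PropositionalEquality using (_≡_)
open import Relation.Nullary using (¬_)

record Pt (k : ℕ) : Set where
  constructor pt
  field
    a  : ℕ
    b  : ℕ
    lt : a + b < k
open Pt public

_≼_ : ∀ {k} → Pt k → Pt k → Set
x ≼ y = (a x ≤ a y) × (b x ≤ b y)

_≺_ : ∀ {k} → Pt k → Pt k → Set
x ≺ y = (x ≼ y) × ¬ (x ≡ y)

-- A strategy sees the whole history (moves in chronological order) and must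
-- either pick a previously unchosen element, or certify that every element
-- has already been chosen (the game is over).
Strategy : ℕ → Set
Strategy k = (h : List (Pt k)) → (Σ (Pt k) λ x → x ∉ h) ⊎ (∀ x → x ∈ h)

even : ℕ → Bool
even zero = true
even (suc zero) = false
even (suc (suc n)) = even n

run : ∀ {k} → Strategy k → Strategy k → ℕ → List (Pt k) → List (Pt k)
run sW sB zero h = h
run sW sB (suc f) h with (if even (length h) then sW h else sB h)
... | inj₁ (x , _) = run sW sB f (h ++ x ∷ [])
... | inj₂ _ = h

-- the complete play (all k(k+1)/2 elements get chosen; fuel k*k+k suffices)
play : (k : ℕ) → Strategy k → Strategy k → List (Pt k)
play k sW sB = run sW sB (k * k + k) []

evens : ∀ {A : Set} → List A → List A
odds  : ∀ {A : Set} → List A → List A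
evens [] = []
evens (x ∷ xs) = x ∷ odds xs
odds [] = []
odds (x ∷ xs) = evens xs

walkerMoves : (k : ℕ) → Strategy k → Strategy k → List (Pt k)
walkerMoves k sW sB = evens (play k sW sB)

BuildsChain : ∀ {k} → ℕ → List (Pt k) → Set
BuildsChain {k} m w = Σ (List (Pt k)) λ c → (c ⊆ w) × Linked _≺_ c × (length c ≡ m)

-- ⌈ 2k / 3 ⌉
ceil2k/3 : ℕ → ℕ
ceil2k/3 k = (2 * k + 2) / 3

-- Points of W²ₖ have rank a + b < k, and x ≺ y forces rank x < rank y.
--
-- Blocker answers a Walker move w as follows: if w covers (lies one unit step above) an earlier
-- Walker point, he claims the free cover of w; otherwise he claims the diagonal point w + (1,1).
-- Inductively, if w covers an earlier Walker point x then x covers no earlier Walker point, so the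
-- diagonal of x is already Blocker's; it is one of the two covers of w, hence after Blocker's answer
-- both covers of w are claimed.  So Walker never makes two cover steps in a row: along any of his
-- chains the rank gaps are at least 1 and never twice in a row equal to 1, which for a chain of n
-- points gives 3(n - 1) + 1 ≤ 2k, that is n ≤ ⌈2k/3⌉.
--
-- Walker starts at the origin and always claims the first free point of least possible rank above
-- his last point p, trying (a p + i + 1, b p) and (a p + i, b p + 1) for i = 0, 1, ….  Every rank
-- level he jumps over is filled by two Blocker points, so after t moves 2 rank p + 2 ≤ 2t + s where
-- s ≤ t counts those Blocker points; hence a free level below k exists as long as 3t + 1 ≤ 2k, that
-- is, as long as t < ⌈2k/3⌉.

module Submission where

open import Defs
open import Data.Bool using (true; false; not; if_then_else_)
open import Data.Empty using (⊥; ⊥-elim)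
open import Data.List
  using (List; []; _∷_; _++_; _∷ʳ_; length; take; last; upTo; cartesianProduct; mapMaybe)
open import Data.List.Properties using (length-take; length-++-≤ˡ; take-all; ∷ʳ-injective)
open import Data.List.Membership.Propositional using (_∈_; _∉_; find; lose)
open import Data.List.Membership.Propositional.Properties
  using (∈-++⁺ˡ; ∈-++⁺ʳ; ∈-++⁻; ∈-cartesianProduct⁺; ∈-upTo⁺)
open import Data.List.Relation.Unary.All as All using (All; []; _∷_)
import Data.List.Relation.Unary.All.Properties as All
open import Data.List.Relation.Unary.Any as Any using (Any; here; there; any?)
import Data.List.Relation.Unary.Any.Properties as Any
open import Data.List.Relation.Unary.AllPairs using ([]; _∷_)
open import Data.List.Relation.Unary.Unique.Propositional using (Unique)
open import Data.List.Relation.Unary.Linked using (Linked; []; [-]; _∷_)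
import Data.List.Relation.Unary.Linked.Properties as Linked
open import Data.List.Relation.Binary.Sublist.Propositional as Sublist
  using (_⊆_; []; _∷_; ⊆-refl; ⊆-trans; from∈; minimum)
import Data.List.Relation.Binary.Sublist.Propositional.Properties as Sublist
open import Data.Maybe using (Maybe; just; nothing)
open import Data.Maybe.Relation.Unary.All as Maybe using (just; nothing)
import Data.Maybe.Relation.Unary.Any as MaybeAny
open import Data.Maybe.Relation.Binary.Connected using (Connected; just)
open import Data.Nat using (ℕ; zero; suc; _+_; _*_; _≤_; _<_; z≤n; s≤s; _≤?_; _<?_)
open import Data.Nat.DivMod using (_/_; m*n/n≡m; m/n*n≤m; /-monoˡ-≤)
open import Data.Nat.Properties
open import Data.Nat.Tactic.RingSolver using (solve-∀)
open import Data.Product as Product using (Σ; ∃-syntax; _×_; _,_; proj₁; proj₂; uncurry)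
open import Data.Sum using (_⊎_; inj₁; inj₂; [_,_]′)
open import Function using (_∘_; flip)
open import Relation.Binary.Definitions using (DecidableEquality)
open import Relation.Binary.PropositionalEquality
open import Relation.Nullary using (¬_; Dec; yes; no)
open import Relation.Nullary.Decidable using (map′; _×-dec_; _⊎-dec_)

module _ {A : Set} where

  even-∷ʳ : ∀ (xs : List A) {x} → even (length (xs ∷ʳ x)) ≡ not (even (length xs))
  even-∷ʳ []           = refl
  even-∷ʳ (_ ∷ [])     = refl
  even-∷ʳ (_ ∷ _ ∷ xs) = even-∷ʳ xs

  even-∷ʳ-∷ʳ : ∀ (xs : List A) {x y} → even (length (xs ∷ʳ x ∷ʳ y)) ≡ even (length xs)
  even-∷ʳ-∷ʳ []           = refl
  even-∷ʳ-∷ʳ (_ ∷ [])     = refl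
  even-∷ʳ-∷ʳ (_ ∷ _ ∷ xs) = even-∷ʳ-∷ʳ xs

  evens-∷ʳ-even : ∀ (xs : List A) {x} → even (length xs) ≡ true → evens (xs ∷ʳ x) ≡ evens xs ∷ʳ x
  evens-∷ʳ-even []           _ = refl
  evens-∷ʳ-even (_ ∷ [])     ()
  evens-∷ʳ-even (y ∷ _ ∷ xs) e = cong (y ∷_) (evens-∷ʳ-even xs e)

  odds-∷ʳ-even : ∀ (xs : List A) {x} → even (length xs) ≡ true → odds (xs ∷ʳ x) ≡ odds xs
  odds-∷ʳ-even []           _ = refl
  odds-∷ʳ-even (_ ∷ [])     ()
  odds-∷ʳ-even (_ ∷ z ∷ xs) e = cong (z ∷_) (odds-∷ʳ-even xs e)

  evens-∷ʳ-odd : ∀ (xs : List A) {x} → even (length xs) ≡ false → evens (xs ∷ʳ x) ≡ evens xs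
  evens-∷ʳ-odd []           ()
  evens-∷ʳ-odd (_ ∷ [])     _ = refl
  evens-∷ʳ-odd (y ∷ _ ∷ xs) e = cong (y ∷_) (evens-∷ʳ-odd xs e)

  odds-∷ʳ-odd : ∀ (xs : List A) {x} → even (length xs) ≡ false → odds (xs ∷ʳ x) ≡ odds xs ∷ʳ x
  odds-∷ʳ-odd []           ()
  odds-∷ʳ-odd (_ ∷ [])     _ = refl
  odds-∷ʳ-odd (_ ∷ z ∷ xs) e = cong (z ∷_) (odds-∷ʳ-odd xs e)

  evens-++ : ∀ (xs ys : List A) → ∃[ zs ] evens (xs ++ ys) ≡ evens xs ++ zs
  evens-++ []           ys = evens ys , refl
  evens-++ (_ ∷ [])     ys = odds ys , refl
  evens-++ (x ∷ _ ∷ xs) ys = Product.map₂ (cong (x ∷_)) (evens-++ xs ys)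

  evens-⊆ : ∀ (xs : List A) → evens xs ⊆ xs
  odds-⊆  : ∀ (xs : List A) → odds xs ⊆ xs
  evens-⊆ []       = []
  evens-⊆ (x ∷ xs) = refl ∷ odds-⊆ xs
  odds-⊆  []       = []
  odds-⊆  (x ∷ xs) = Sublist.++⁺ˡ (x ∷ []) (evens-⊆ xs)

  ∈-evens-or-odds : ∀ {x} (xs : List A) → x ∈ xs → x ∈ evens xs ⊎ x ∈ odds xs
  ∈-evens-or-odds (_ ∷ xs) (here e)   = inj₁ (here e)
  ∈-evens-or-odds (_ ∷ xs) (there x∈) = [ inj₂ , inj₁ ∘ there ]′ (∈-evens-or-odds xs x∈)

  length-odds≤length-evens : ∀ (xs : List A) → length (odds xs) ≤ length (evens xs)
  length-odds≤length-evens []           = z≤n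
  length-odds≤length-evens (_ ∷ [])     = z≤n
  length-odds≤length-evens (_ ∷ _ ∷ xs) = s≤s (length-odds≤length-evens xs)

  length-evens-odds : ∀ (xs : List A) → length xs ≡ length (evens xs) + length (odds xs)
  length-evens-odds []       = refl
  length-evens-odds (_ ∷ xs) =
    cong suc (trans (length-evens-odds xs) (+-comm (length (evens xs)) (length (odds xs))))

  length-∷ʳ : ∀ (xs : List A) {x} → length (xs ∷ʳ x) ≡ suc (length xs)
  length-∷ʳ []       = refl
  length-∷ʳ (_ ∷ xs) = cong suc (length-∷ʳ xs)

  last-∷ʳ : ∀ (xs : List A) {x} → last (xs ∷ʳ x) ≡ just x
  last-∷ʳ []           = refl
  last-∷ʳ (_ ∷ [])     = refl
  last-∷ʳ (_ ∷ y ∷ xs) = last-∷ʳ (y ∷ xs)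

  take-++-≤ : ∀ n (xs : List A) {ys} → n ≤ length xs → take n (xs ++ ys) ≡ take n xs
  take-++-≤ zero    xs       _         = refl
  take-++-≤ (suc n) (x ∷ xs) (s≤s n≤) = cong (x ∷_) (take-++-≤ n xs n≤)

  ⊆-∷ʳ⁻ : ∀ {xs} (ys : List A) {y} → xs ⊆ ys ∷ʳ y → xs ⊆ ys ⊎ ∃[ zs ] xs ≡ zs ∷ʳ y × zs ⊆ ys
  ⊆-∷ʳ⁻ []       (Sublist._∷ʳ_ _ s) = inj₁ s
  ⊆-∷ʳ⁻ []       (refl ∷ [])        = inj₂ ([] , refl , [])
  ⊆-∷ʳ⁻ (z ∷ ys) (Sublist._∷ʳ_ _ s) with ⊆-∷ʳ⁻ ys s
  ... | inj₁ s′            = inj₁ (Sublist.++⁺ˡ (z ∷ []) s′)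
  ... | inj₂ (zs , e , s′) = inj₂ (zs , e , Sublist.++⁺ˡ (z ∷ []) s′)
  ⊆-∷ʳ⁻ (z ∷ ys) (refl ∷ s) with ⊆-∷ʳ⁻ ys s
  ... | inj₁ s′               = inj₁ (refl ∷ s′)
  ... | inj₂ (zs , refl , s′) = inj₂ (z ∷ zs , refl , refl ∷ s′)

  ∃-deletion : ∀ {x} (ys : List A) → x ∈ ys →
               ∃[ zs ] length ys ≡ suc (length zs) × (∀ {y} → y ∈ ys → y ≢ x → y ∈ zs)
  ∃-deletion (_ ∷ ys) (here refl) = ys , refl , λ where
    (here refl) y≢x → ⊥-elim (y≢x refl)
    (there y∈) _    → y∈
  ∃-deletion (z ∷ ys) (there x∈) with ∃-deletion ys x∈
  ... | zs , e , keep = z ∷ zs , cong suc e , λ where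
    (here e′)  _   → here e′
    (there y∈) y≢x → there (keep y∈ y≢x)

  Unique-length-≤ : ∀ {xs ys : List A} → Unique xs → All (_∈ ys) xs → length xs ≤ length ys
  Unique-length-≤ []                  []           = z≤n
  Unique-length-≤ {ys = ys} (x≢ ∷ u) (x∈ ∷ xs∈) with ∃-deletion ys x∈
  ... | zs , e , keep = subst (_ ≤_) (sym e)
        (s≤s (Unique-length-≤ u (All.zipWith (λ (y≢x , y∈) → keep y∈ (y≢x ∘ sym)) (x≢ , xs∈))))

≤+≤≡⇒≡ : ∀ {p q r s} → p ≤ q → r ≤ s → p + r ≡ q + s → p ≡ q × r ≡ s
≤+≤≡⇒≡ {p} p≤q r≤s e with m≤n⇒m<n∨m≡n p≤q
... | inj₁ p<q  = ⊥-elim (<-irrefl e (+-mono-<-≤ p<q r≤s))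
... | inj₂ refl = refl , +-cancelˡ-≡ p _ _ e

≤-ceil2k/3 : ∀ k {n} → 3 * n ≤ 2 * k + 2 → n ≤ ceil2k/3 k
≤-ceil2k/3 k {n} 3n≤ = begin
  n               ≡⟨ m*n/n≡m n 3 ⟨
  n * 3 / 3       ≤⟨ /-monoˡ-≤ 3 (subst (_≤ 2 * k + 2) (*-comm 3 n) 3n≤) ⟩
  (2 * k + 2) / 3 ∎
  where open ≤-Reasoning

<-ceil2k/3⇒ : ∀ k {t} → suc t ≤ ceil2k/3 k → 3 * t + 1 ≤ 2 * k
<-ceil2k/3⇒ k {t} t<m = +-cancelʳ-≤ 2 (3 * t + 1) (2 * k) (begin
  3 * t + 1 + 2       ≡⟨ lhs t ⟩
  3 * suc t           ≤⟨ *-monoʳ-≤ 3 t<m ⟩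
  3 * ceil2k/3 k      ≡⟨ *-comm 3 (ceil2k/3 k) ⟩
  ceil2k/3 k * 3      ≤⟨ m/n*n≤m (2 * k + 2) 3 ⟩
  2 * k + 2           ∎)
  where
  open ≤-Reasoning
  lhs : ∀ t → 3 * t + 1 + 2 ≡ 3 * suc t
  lhs = solve-∀

module _ {k : ℕ} (sW sB : Strategy k) where

  mover : Strategy k
  mover h = if even (length h) then sW h else sB h

  mover-odd : ∀ {h} → even (length h) ≡ false → mover h ≡ sB h
  mover-odd {h} e rewrite e = refl

  run-invariant : (P : List (Pt k) → Set) →
                  (∀ {h x x∉h} → mover h ≡ inj₁ (x , x∉h) → P h → P (h ∷ʳ x)) →
                  ∀ f {h} → P h → P (run sW sB f h)
  run-invariant P step zero    Ph = Ph
  run-invariant P step (suc f) {h} Ph with if even (length h) then sW h else sB h in e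
  ... | inj₁ (x , x∉h) = run-invariant P step f (step e Ph)
  ... | inj₂ _         = Ph

  run-length-or-complete : ∀ f h → length (run sW sB f h) ≡ f + length h ⊎ (∀ x → x ∈ run sW sB f h)
  run-length-or-complete zero    h = inj₁ refl
  run-length-or-complete (suc f) h with if even (length h) then sW h else sB h
  ... | inj₂ all∈ = inj₂ all∈
  ... | inj₁ (x , _) with run-length-or-complete f (h ∷ʳ x)
  ...   | inj₂ all∈ = inj₂ all∈
  ...   | inj₁ len  = inj₁ (trans len (trans (cong (f +_) (length-∷ʳ h)) (+-suc f (length h))))

module Wedge (k : ℕ) where

  rank : Pt k → ℕ
  rank x = a x + b x

  pt-≡ : ∀ {x y : Pt k} → a x ≡ a y → b x ≡ b y → x ≡ y
  pt-≡ {pt _ _ _} {pt _ _ _} refl refl = cong (pt _ _) (<-irrelevant _ _)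

  _≟ₚ_ : DecidableEquality (Pt k)
  x ≟ₚ y = map′ (uncurry pt-≡) (λ e → cong a e , cong b e) (a x ≟ a y ×-dec b x ≟ b y)

  open import Data.List.Membership.DecPropositional _≟ₚ_ using (_∈?_)

  point? : ℕ → ℕ → Maybe (Pt k)
  point? x y with x + y <? k
  ... | yes l = just (pt x y l)
  ... | no _  = nothing

  point?-≡ : ∀ x → point? (a x) (b x) ≡ just x
  point?-≡ (pt x y l) with x + y <? k
  ... | yes _ = cong just (pt-≡ refl refl)
  ... | no ¬l = ⊥-elim (¬l l)

  points : List (Pt k)
  points = mapMaybe (uncurry point?) (cartesianProduct (upTo k) (upTo k))

  ∈-points : ∀ x → x ∈ points
  ∈-points x = Any.mapMaybe⁺ (uncurry point?) _ (Any.map⁺ (Any.map found coords∈))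
    where
    coords∈ : (a x , b x) ∈ cartesianProduct (upTo k) (upTo k)
    coords∈ = ∈-cartesianProduct⁺ (∈-upTo⁺ (≤-<-trans (m≤m+n (a x) (b x)) (lt x)))
                                  (∈-upTo⁺ (≤-<-trans (m≤n+m (b x) (a x)) (lt x)))
    found : ∀ {c} → (a x , b x) ≡ c → MaybeAny.Any (x ≡_) (uncurry point? c)
    found refl = subst (MaybeAny.Any (x ≡_)) (sym (point?-≡ x)) (MaybeAny.just refl)

  -- Strategies claiming the first free candidate

  Move : List (Pt k) → Set
  Move h = (Σ (Pt k) λ x → x ∉ h) ⊎ (∀ x → x ∈ h)

  data Picks {h} (P : Pt k → Set) : Move h → Set where
    picks : ∀ {x x∉h} → P x → Picks P (inj₁ (x , x∉h))

  Picks-≡ : ∀ {h P} {r : Move h} {x x∉h} → Picks P r → r ≡ inj₁ (x , x∉h) → P x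
  Picks-≡ (picks Px) refl = Px

  Picks⇒incomplete : ∀ {h P} {r : Move h} → Picks P r → ¬ (∀ x → x ∈ h)
  Picks⇒incomplete (picks {x} {x∉h} _) all∈ = x∉h (all∈ x)

  unclaimed : Strategy k
  unclaimed h with All.all? (_∈? h) points
  ... | yes all∈ = inj₂ (λ x → All.lookup all∈ (∈-points x))
  ... | no ¬all∈ = inj₁ (Any.satisfied (All.¬All⇒Any¬ (_∈? h) points ¬all∈))

  pickFrom : List (Maybe (Pt k)) → Strategy k
  pickFrom []             h = unclaimed h
  pickFrom (nothing ∷ cs) h = pickFrom cs h
  pickFrom (just c ∷ cs)  h with c ∈? h
  ... | yes _   = pickFrom cs h
  ... | no c∉h = inj₁ (c , c∉h)

  Claimed : List (Pt k) → Maybe (Pt k) → Set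
  Claimed h = Maybe.All (_∈ h)

  Claimed-∷ʳ : ∀ {h c x} → Claimed h c → Claimed (h ∷ʳ x) c
  Claimed-∷ʳ = Maybe.map ∈-++⁺ˡ

  pickFrom-skip : ∀ {h c} cs → Claimed h c → pickFrom (c ∷ cs) h ≡ pickFrom cs h
  pickFrom-skip     cs nothing = refl
  pickFrom-skip {h} cs (just {c} c∈h) with c ∈? h
  ... | yes _   = refl
  ... | no c∉h = ⊥-elim (c∉h c∈h)

  pickFrom-claims : ∀ {h c cs x x∉h} → All (Claimed h) cs → pickFrom (c ∷ cs) h ≡ inj₁ (x , x∉h) →
                    All (Claimed (h ∷ʳ x)) (c ∷ cs)
  pickFrom-claims {c = nothing} cs∈ _ = nothing ∷ All.map Claimed-∷ʳ cs∈
  pickFrom-claims {h} {just c} cs∈ picked with c ∈? h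
  ... | yes c∈h = just (∈-++⁺ˡ c∈h) ∷ All.map Claimed-∷ʳ cs∈
  pickFrom-claims {h} {just c} cs∈ refl | no _ = just (∈-++⁺ʳ h (here refl)) ∷ All.map Claimed-∷ʳ cs∈

  pickFrom-claims-pair : ∀ {h c₁ c₂ x x∉h} → Claimed h c₁ ⊎ Claimed h c₂ →
                         pickFrom (c₁ ∷ c₂ ∷ []) h ≡ inj₁ (x , x∉h) →
                         All (Claimed (h ∷ʳ x)) (c₁ ∷ c₂ ∷ [])
  pickFrom-claims-pair (inj₂ c₂∈) picked = pickFrom-claims (c₂∈ ∷ []) picked
  pickFrom-claims-pair (inj₁ c₁∈) picked =
    Claimed-∷ʳ c₁∈ ∷ pickFrom-claims [] (trans (sym (pickFrom-skip _ c₁∈)) picked)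

  -- The order and its covering relation

  ≼-rank-≡ : ∀ {x y} → x ≼ y → rank x ≡ rank y → x ≡ y
  ≼-rank-≡ (a≤ , b≤) e = uncurry pt-≡ (≤+≤≡⇒≡ a≤ b≤ e)

  ≺⇒rank< : ∀ {x y} → x ≺ y → rank x < rank y
  ≺⇒rank< (x≼y@(a≤ , b≤) , x≢y) = ≤∧≢⇒< (+-mono-≤ a≤ b≤) (x≢y ∘ ≼-rank-≡ x≼y)

  data _⋖_ (x y : Pt k) : Set where
    ⋖ᵃ : a y ≡ suc (a x) → b y ≡ b x → x ⋖ y
    ⋖ᵇ : a y ≡ a x → b y ≡ suc (b x) → x ⋖ y

  _⋖?_ : ∀ x y → Dec (x ⋖ y)
  x ⋖? y = map′ [ uncurry ⋖ᵃ , uncurry ⋖ᵇ ]′ split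
                ((a y ≟ suc (a x) ×-dec b y ≟ b x) ⊎-dec (a y ≟ a x ×-dec b y ≟ suc (b x)))
    where
    split : x ⋖ y → _
    split (⋖ᵃ e₁ e₂) = inj₁ (e₁ , e₂)
    split (⋖ᵇ e₁ e₂) = inj₂ (e₁ , e₂)

  ⋖-irrefl : ∀ {x} → ¬ x ⋖ x
  ⋖-irrefl (⋖ᵃ e _) = 1+n≢n (sym e)
  ⋖-irrefl (⋖ᵇ _ e) = 1+n≢n (sym e)

  ≺-rank-suc⇒⋖ : ∀ {x y} → x ≺ y → rank y ≡ suc (rank x) → x ⋖ y
  ≺-rank-suc⇒⋖ {x} {y} ((a≤ , b≤) , _) e with m≤n⇒m<n∨m≡n a≤
  ... | inj₁ a< = uncurry ⋖ᵃ (Product.map sym sym (≤+≤≡⇒≡ a< b≤ (sym e)))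
  ... | inj₂ a≡ = ⋖ᵇ (sym a≡) (+-cancelˡ-≡ (a y) _ _ (begin
    a y + b y         ≡⟨ e ⟩
    suc (a x + b x)   ≡⟨ +-suc (a x) (b x) ⟨
    a x + suc (b x)   ≡⟨ cong (_+ suc (b x)) a≡ ⟩
    a y + suc (b x)   ∎))
    where open ≡-Reasoning

  ⋖⇒rank-suc : ∀ {x y} → x ⋖ y → rank y ≡ suc (rank x)
  ⋖⇒rank-suc         (⋖ᵃ e₁ e₂) = cong₂ _+_ e₁ e₂
  ⋖⇒rank-suc {x} {y} (⋖ᵇ e₁ e₂) = trans (cong₂ _+_ e₁ e₂) (+-suc (a x) (b x))

  up₁ up₂ diag : Pt k → Maybe (Pt k)
  up₁  y = point? (suc (a y)) (b y)
  up₂  y = point? (a y) (suc (b y))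
  diag y = point? (suc (a y)) (suc (b y))

  ⋖⇒up : ∀ {y z} → y ⋖ z → up₁ y ≡ just z ⊎ up₂ y ≡ just z
  ⋖⇒up {z = z} (⋖ᵃ e₁ e₂) = inj₁ (trans (cong₂ point? (sym e₁) (sym e₂)) (point?-≡ z))
  ⋖⇒up {z = z} (⋖ᵇ e₁ e₂) = inj₂ (trans (cong₂ point? (sym e₁) (sym e₂)) (point?-≡ z))

  ⋖⇒up-diag : ∀ {x w} → x ⋖ w → up₂ w ≡ diag x ⊎ up₁ w ≡ diag x
  ⋖⇒up-diag (⋖ᵃ e₁ e₂) = inj₁ (cong₂ point? e₁ (cong suc e₂))
  ⋖⇒up-diag (⋖ᵇ e₁ e₂) = inj₂ (cong₂ point? (cong suc e₁) e₂)

  -- Blocker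

  Covered : List (Pt k) → Pt k → Set
  Covered H y = All (Claimed H) (up₁ y ∷ up₂ y ∷ [])

  Covered⇒∈ : ∀ {H y z} → Covered H y → y ⋖ z → z ∈ H
  Covered⇒∈ {H} (c₁ ∷ c₂ ∷ []) y⋖z with ⋖⇒up y⋖z
  ... | inj₁ e = Maybe.drop-just (subst (Claimed H) e c₁)
  ... | inj₂ e = Maybe.drop-just (subst (Claimed H) e c₂)

  Stepped : List (Pt k) → Pt k → Set
  Stepped W y = ∃[ x ] (x ∷ y ∷ []) ⊆ W × x ⋖ y

  Stepped-∷ʳ⁺ : ∀ {W w y} → Stepped W y → Stepped (W ∷ʳ w) y
  Stepped-∷ʳ⁺ (x , s , x⋖y) = x , Sublist.++⁺ʳ _ s , x⋖y

  ∷ʳ-covering : ∀ {W w} → Any (_⋖ w) (W ∷ʳ w) → ∃[ x ] x ∈ W × x ⋖ w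
  ∷ʳ-covering {W} any with find any
  ... | x , x∈ , x⋖w with ∈-++⁻ W x∈
  ...   | inj₁ x∈W        = x , x∈W , x⋖w
  ...   | inj₂ (here refl) = ⊥-elim (⋖-irrefl x⋖w)

  NoCoverTriple : List (Pt k) → Set
  NoCoverTriple W = ∀ {x y z} → (x ∷ y ∷ z ∷ []) ⊆ W → x ⋖ y → y ⋖ z → ⊥

  record Guarded (H W : List (Pt k)) : Set where
    field
      stepped⇒covered : ∀ {x y} → (x ∷ y ∷ []) ⊆ W → x ⋖ y → Covered H y
      unstepped⇒diag  : ∀ {y} → y ∈ W → ¬ Stepped W y → Claimed H (diag y)
  open Guarded

  Guarded-[] : Guarded [] []
  Guarded-[] = record { stepped⇒covered = λ () ; unstepped⇒diag = λ () }

  responses : List (Pt k) → Pt k → List (Maybe (Pt k))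
  responses W w with any? (_⋖? w) W
  ... | yes _ = up₁ w ∷ up₂ w ∷ []
  ... | no _  = diag w ∷ []

  blocker : Strategy k
  blocker h with last (evens h)
  ... | nothing = unclaimed h
  ... | just w  = pickFrom (responses (evens h) w) h

  blocker-responds : ∀ {h w} → last (evens h) ≡ just w → blocker h ≡ pickFrom (responses (evens h) w) h
  blocker-responds {h} e with last (evens h)
  blocker-responds refl | just _ = refl

  blocker-answers : ∀ {h w} → even (length h) ≡ true →
                    blocker (h ∷ʳ w) ≡ pickFrom (responses (evens h ∷ʳ w) w) (h ∷ʳ w)
  blocker-answers {h} {w} ev = begin
    blocker (h ∷ʳ w)                                 ≡⟨ blocker-responds (trans (cong last E) (last-∷ʳ (evens h))) ⟩
    pickFrom (responses (evens (h ∷ʳ w)) w) (h ∷ʳ w) ≡⟨ cong (λ W → pickFrom (responses W w) (h ∷ʳ w)) E ⟩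
    pickFrom (responses (evens h ∷ʳ w) w) (h ∷ʳ w)   ∎
    where
    open ≡-Reasoning
    E : evens (h ∷ʳ w) ≡ evens h ∷ʳ w
    E = evens-∷ʳ-even h ev

  module GuardedStep {h W w x x∉} (g : Guarded h W) (w∉h : w ∉ h) (w∉W : w ∉ W)
                     (picked : pickFrom (responses (W ∷ʳ w) w) (h ∷ʳ w) ≡ inj₁ (x , x∉)) where

    -- x₀ is not stepped, since its covers (w among them) would be claimed; so its diagonal, which is
    -- one of the two covers of w, is claimed already.
    covered-w : ∀ {x₀} → x₀ ∈ W → x₀ ⋖ w → Covered (h ∷ʳ w ∷ʳ x) w
    covered-w {x₀} x₀∈W x₀⋖w with any? (_⋖? w) (W ∷ʳ w)
    ... | no ¬any = ⊥-elim (¬any (lose (∈-++⁺ˡ x₀∈W) x₀⋖w))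
    ... | yes _   = pickFrom-claims-pair up-claimed picked
      where
      x₀-unstepped : ¬ Stepped W x₀
      x₀-unstepped (_ , s , x⋖x₀) = w∉h (Covered⇒∈ (stepped⇒covered g s x⋖x₀) x₀⋖w)
      diag-claimed : Claimed (h ∷ʳ w) (diag x₀)
      diag-claimed = Claimed-∷ʳ (unstepped⇒diag g x₀∈W x₀-unstepped)
      up-claimed : Claimed (h ∷ʳ w) (up₁ w) ⊎ Claimed (h ∷ʳ w) (up₂ w)
      up-claimed with ⋖⇒up-diag x₀⋖w
      ... | inj₁ e = inj₂ (subst (Claimed _) (sym e) diag-claimed)
      ... | inj₂ e = inj₁ (subst (Claimed _) (sym e) diag-claimed)

    diag-w : ¬ Stepped (W ∷ʳ w) w → Claimed (h ∷ʳ w ∷ʳ x) (diag w)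
    diag-w ¬stepped with any? (_⋖? w) (W ∷ʳ w)
    ... | no _ = All.head (pickFrom-claims [] picked)
    ... | yes any with ∷ʳ-covering any
    ...   | x₀ , x₀∈W , x₀⋖w = ⊥-elim (¬stepped (x₀ , Sublist.++⁺ (from∈ x₀∈W) ⊆-refl , x₀⋖w))

    guarded-∷ʳ : Guarded (h ∷ʳ w ∷ʳ x) (W ∷ʳ w)
    stepped⇒covered guarded-∷ʳ {x₀} s x₀⋖y with ⊆-∷ʳ⁻ W s
    ... | inj₁ s′ = All.map (Claimed-∷ʳ ∘ Claimed-∷ʳ) (stepped⇒covered g s′ x₀⋖y)
    ... | inj₂ (zs , e , zs⊆W) with ∷ʳ-injective (x₀ ∷ []) zs e
    ...   | refl , refl = covered-w (Sublist.lookup zs⊆W (here refl)) x₀⋖y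
    unstepped⇒diag guarded-∷ʳ y∈ ¬stepped with ∈-++⁻ W y∈
    ... | inj₁ y∈W        = Claimed-∷ʳ (Claimed-∷ʳ (unstepped⇒diag g y∈W (¬stepped ∘ Stepped-∷ʳ⁺)))
    ... | inj₂ (here refl) = diag-w ¬stepped

  open GuardedStep using (guarded-∷ʳ)

  NoCoverTriple-∷ʳ : ∀ {h W w} → Guarded h W → w ∉ h → NoCoverTriple W → NoCoverTriple (W ∷ʳ w)
  NoCoverTriple-∷ʳ {W = W} g w∉h nct {x} {y} s x⋖y y⋖w with ⊆-∷ʳ⁻ W s
  ... | inj₁ s′ = nct s′ x⋖y y⋖w
  ... | inj₂ (zs , e , zs⊆W) with ∷ʳ-injective (x ∷ y ∷ []) zs e
  ...   | refl , refl = w∉h (Covered⇒∈ (stepped⇒covered g zs⊆W x⋖y) y⋖w)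

  data BlockerInv : List (Pt k) → Set where
    walker-to-move  : ∀ {h} → even (length h) ≡ true → Guarded h (evens h) → NoCoverTriple (evens h) →
                      BlockerInv h
    blocker-to-move : ∀ {h w} → even (length h) ≡ true → Guarded h (evens h) →
                      NoCoverTriple (evens h ∷ʳ w) → w ∉ h → BlockerInv (h ∷ʳ w)

  BlockerInv⇒NoCoverTriple : ∀ {h} → BlockerInv h → NoCoverTriple (evens h)
  BlockerInv⇒NoCoverTriple (walker-to-move _ _ nct)          = nct
  BlockerInv⇒NoCoverTriple (blocker-to-move {h} ev _ nct _) = subst NoCoverTriple (sym (evens-∷ʳ-even h ev)) nct

  BlockerInv-step : ∀ sW {h x x∉h} → mover sW blocker h ≡ inj₁ (x , x∉h) → BlockerInv h → BlockerInv (h ∷ʳ x)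
  BlockerInv-step sW {x∉h = x∉h} _ (walker-to-move ev g nct) =
    blocker-to-move ev g (NoCoverTriple-∷ʳ g x∉h nct) x∉h
  BlockerInv-step sW {x = x} {x∉h = x∉} moved (blocker-to-move {h} {w} ev g nct w∉h) =
    walker-to-move (trans (even-∷ʳ-∷ʳ h) ev)
      (subst (Guarded _) (sym evens≡) (guarded-∷ʳ g w∉h (w∉h ∘ Sublist.lookup (evens-⊆ h)) picked))
      (subst NoCoverTriple (sym evens≡) nct)
    where
    odd : even (length (h ∷ʳ w)) ≡ false
    odd = trans (even-∷ʳ h) (cong not ev)
    evens≡ : evens (h ∷ʳ w ∷ʳ x) ≡ evens h ∷ʳ w
    evens≡ = trans (evens-∷ʳ-odd (h ∷ʳ w) odd) (evens-∷ʳ-even h ev)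
    picked : pickFrom (responses (evens h ∷ʳ w) w) (h ∷ʳ w) ≡ inj₁ (x , x∉)
    picked = trans (sym (blocker-answers ev)) (trans (sym (mover-odd sW blocker odd)) moved)

  StepsByCover : Pt k → List (Pt k) → Set
  StepsByCover x []      = ⊥
  StepsByCover x (y ∷ _) = x ⋖ y

  NoCoverTriple⇒¬StepsByCover : ∀ {x y zs} → NoCoverTriple (x ∷ y ∷ zs) → x ⋖ y → ¬ StepsByCover y zs
  NoCoverTriple⇒¬StepsByCover {zs = []}    _   _   ()
  NoCoverTriple⇒¬StepsByCover {zs = _ ∷ _} nct x⋖y y⋖z = nct (refl ∷ refl ∷ refl ∷ minimum _) x⋖y y⋖z

  chain-bound : ∀ x cs → Linked _≺_ (x ∷ cs) → NoCoverTriple (x ∷ cs) →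
                3 * length cs + 2 * rank x + 1 ≤ 2 * k ×
                (¬ StepsByCover x cs → 3 * length cs + 2 * rank x + 2 ≤ 2 * k)
  chain-bound x [] _ _ = ≤-trans (+-monoʳ-≤ (2 * rank x) (s≤s z≤n)) top , λ _ → top
    where
    double-suc : ∀ r → 2 * suc r ≡ 2 * r + 2
    double-suc = solve-∀
    top : 2 * rank x + 2 ≤ 2 * k
    top = subst (_≤ 2 * k) (double-suc (rank x)) (*-monoʳ-≤ 2 (lt x))
  chain-bound x (y ∷ cs) (x≺y ∷ chain) nct = covered , uncovered
    where
    open ≤-Reasoning
    L = length cs
    from-y : 3 * L + 2 * rank y + 1 ≤ 2 * k × (¬ StepsByCover y cs → 3 * L + 2 * rank y + 2 ≤ 2 * k)
    from-y = chain-bound y cs chain (nct ∘ Sublist.++⁺ˡ (x ∷ []))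
    uncovered : ¬ x ⋖ y → 3 * suc L + 2 * rank x + 2 ≤ 2 * k
    uncovered x⋪y = begin
      3 * suc L + 2 * rank x + 2 ≡⟨ shift L (rank x) ⟩
      3 * L + 2 * (2 + rank x) + 1 ≤⟨ +-monoˡ-≤ 1 (+-monoʳ-≤ (3 * L) (*-monoʳ-≤ 2 gap)) ⟩
      3 * L + 2 * rank y + 1       ≤⟨ proj₁ from-y ⟩
      2 * k                        ∎
      where
      shift : ∀ L r → 3 * suc L + 2 * r + 2 ≡ 3 * L + 2 * (2 + r) + 1
      shift = solve-∀
      gap : 2 + rank x ≤ rank y
      gap = ≤∧≢⇒< (≺⇒rank< x≺y) (x⋪y ∘ ≺-rank-suc⇒⋖ x≺y ∘ sym)
    covered : 3 * suc L + 2 * rank x + 1 ≤ 2 * k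
    covered with x ⋖? y
    ... | no x⋪y  = ≤-trans (+-monoʳ-≤ (3 * suc L + 2 * rank x) (s≤s z≤n)) (uncovered x⋪y)
    ... | yes x⋖y = begin
      3 * suc L + 2 * rank x + 1     ≡⟨ shift L (rank x) ⟩
      3 * L + 2 * suc (rank x) + 2   ≡⟨ cong (λ r → 3 * L + 2 * r + 2) (⋖⇒rank-suc x⋖y) ⟨
      3 * L + 2 * rank y + 2         ≤⟨ proj₂ from-y (NoCoverTriple⇒¬StepsByCover nct x⋖y) ⟩
      2 * k                          ∎
      where
      shift : ∀ L r → 3 * suc L + 2 * r + 1 ≡ 3 * L + 2 * suc r + 2
      shift = solve-∀

  blocker-wins : (sW : Strategy k) (c : List (Pt k)) → c ⊆ walkerMoves k sW blocker → Linked _≺_ c →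
                 length c ≤ ceil2k/3 k
  blocker-wins sW []       _  _     = z≤n
  blocker-wins sW (x ∷ cs) c⊆ chain = ≤-ceil2k/3 k (begin
    3 * suc (length cs)               ≡⟨ shift (length cs) ⟩
    3 * length cs + 0 + 1 + 2         ≤⟨ +-monoˡ-≤ 2 (+-monoˡ-≤ 1 (+-monoʳ-≤ (3 * length cs) z≤n)) ⟩
    3 * length cs + 2 * rank x + 1 + 2 ≤⟨ +-monoˡ-≤ 2 (proj₁ (chain-bound x cs chain (no-triple ∘ flip ⊆-trans c⊆))) ⟩
    2 * k + 2                         ∎)
    where
    open ≤-Reasoning
    shift : ∀ L → 3 * suc L ≡ 3 * L + 0 + 1 + 2
    shift = solve-∀
    no-triple : NoCoverTriple (walkerMoves k sW blocker)
    no-triple = BlockerInv⇒NoCoverTriple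
      (run-invariant sW blocker BlockerInv (BlockerInv-step sW) (k * k + k) (walker-to-move refl Guarded-[] (λ ())))

  -- Walker

  rank-raiseᵃ : ∀ α β i → suc (α + i) + β ≡ suc (α + β + i)
  rank-raiseᵃ = solve-∀

  rank-raiseᵇ : ∀ α β i → α + i + suc β ≡ suc (α + β + i)
  rank-raiseᵇ = solve-∀

  raiseᵃ raiseᵇ : (p : Pt k) (i : ℕ) → suc (rank p + i) < k → Pt k
  raiseᵃ p i l = pt (suc (a p + i)) (b p) (subst (_< k) (sym (rank-raiseᵃ (a p) (b p) i)) l)
  raiseᵇ p i l = pt (a p + i) (suc (b p)) (subst (_< k) (sym (rank-raiseᵇ (a p) (b p) i)) l)

  ≺-raiseᵃ : ∀ p i l → p ≺ raiseᵃ p i l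
  ≺-raiseᵃ p i l = (≤-trans (m≤m+n (a p) i) (n≤1+n _) , ≤-refl) , m≢1+m+n (a p) ∘ cong a

  ≺-raiseᵇ : ∀ p i l → p ≺ raiseᵇ p i l
  ≺-raiseᵇ p i l = (m≤m+n (a p) i , n≤1+n (b p)) , 1+n≢n ∘ sym ∘ cong b

  raiseᵃ≢raiseᵇ : ∀ p i l → raiseᵃ p i l ≢ raiseᵇ p i l
  raiseᵃ≢raiseᵇ p i l = 1+n≢n ∘ sym ∘ cong b

  -- Level i holds the two points of rank rank p + 1 + i nearest to p; n is fuel, with i + n = k.
  upCandidates : Pt k → ℕ → ℕ → List (Maybe (Pt k))
  upCandidates p i zero    = []
  upCandidates p i (suc n) with suc (rank p + i) <? k
  ... | yes l = just (raiseᵃ p i l) ∷ just (raiseᵇ p i l) ∷ upCandidates p (suc i) n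
  ... | no _  = []

  walker : Strategy k
  walker h with last (evens h)
  ... | nothing = pickFrom (point? 0 0 ∷ []) h
  ... | just p  = pickFrom (upCandidates p 0 k) h

  walker-continues : ∀ {h p} → last (evens h) ≡ just p → walker h ≡ pickFrom (upCandidates p 0 k) h
  walker-continues {h} e with last (evens h)
  walker-continues refl | just _ = refl

  walker-opens : 1 ≤ k → Picks (λ q → rank q ≡ 0) (walker [])
  walker-opens k≥1 with 0 <? k
  ... | yes _   = picks refl
  ... | no k≯0 = ⊥-elim (k≯0 k≥1)

  -- `blocked` holds the Blocker points on the rank levels Walker has jumped over, two per level.
  record Budget (t r : ℕ) (B : List (Pt k)) : Set where
    constructor budget
    field
      blocked    : List (Pt k)
      unique     : Unique blocked
      by-blocker : All (_∈ B) blocked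
      low        : All (λ s → rank s ≤ r) blocked
      bound      : 2 * r + 2 ≤ 2 * t + length blocked

  Budget-∷ʳ : ∀ {t r B x} → Budget t r B → Budget t r (B ∷ʳ x)
  Budget-∷ʳ (budget S u by low bd) = budget S u (All.map ∈-++⁺ˡ by) low bd

  level-below-k : ∀ {t r B} → Budget t r B → length B ≤ t → 3 * t + 1 ≤ 2 * k → suc r < k
  level-below-k {t} {r} {B} (budget S u by _ bd) B≤t ht = *-cancelˡ-< 2 (suc r) k (begin-strict
    2 * suc r        ≡⟨ double-suc r ⟩
    2 * r + 2        ≤⟨ bd ⟩
    2 * t + length S ≤⟨ +-monoʳ-≤ (2 * t) (≤-trans (Unique-length-≤ u by) B≤t) ⟩
    2 * t + t        ≡⟨ triple t ⟩
    3 * t            <⟨ m<m+n (3 * t) (s≤s z≤n) ⟩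
    3 * t + 1        ≤⟨ ht ⟩
    2 * k            ∎)
    where
    open ≤-Reasoning
    double-suc : ∀ r → 2 * suc r ≡ 2 * r + 2
    double-suc = solve-∀
    triple : ∀ t → 2 * t + t ≡ 3 * t
    triple = solve-∀

  raise-bound : ∀ {r t s} → 2 * r + 2 ≤ 2 * t + s → 2 * suc r + 2 ≤ 2 * t + s + 2
  raise-bound {r} {t} {s} bd = subst (_≤ 2 * t + s + 2) (sym (two-more r)) (+-monoˡ-≤ 2 bd)
    where
    two-more : ∀ r → 2 * suc r + 2 ≡ 2 * r + 2 + 2
    two-more = solve-∀

  Budget-advance : ∀ {t r B} q → Budget t r B → rank q ≡ suc r → Budget (suc t) (rank q) B
  Budget-advance {t} {r} q (budget S u by low bd) e =
    budget S u by (All.map (λ s≤r → ≤-trans s≤r (≤-trans (n≤1+n r) (≤-reflexive (sym e)))) low) (begin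
      2 * rank q + 2       ≡⟨ cong (λ ρ → 2 * ρ + 2) e ⟩
      2 * suc r + 2        ≤⟨ raise-bound {t = t} {s = length S} bd ⟩
      2 * t + length S + 2 ≡⟨ shift t (length S) ⟩
      2 * suc t + length S ∎)
    where
    open ≤-Reasoning
    shift : ∀ t s → 2 * t + s + 2 ≡ 2 * suc t + s
    shift = solve-∀

  Budget-skip : ∀ {t r B} q₁ q₂ → Budget t r B → rank q₁ ≡ suc r → rank q₂ ≡ suc r → q₁ ≢ q₂ →
                q₁ ∈ B → q₂ ∈ B → Budget t (suc r) B
  Budget-skip {t} {r} q₁ q₂ (budget S u by low bd) e₁ e₂ q₁≢q₂ q₁∈ q₂∈ =
    budget (q₁ ∷ q₂ ∷ S) ((q₁≢q₂ ∷ All.map (fresh e₁) low) ∷ All.map (fresh e₂) low ∷ u) (q₁∈ ∷ q₂∈ ∷ by)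
           (≤-reflexive e₁ ∷ ≤-reflexive e₂ ∷ All.map (λ s≤r → ≤-trans s≤r (n≤1+n r)) low)
           (subst (2 * suc r + 2 ≤_) (shift t (length S)) (raise-bound {t = t} {s = length S} bd))
    where
    fresh : ∀ {q s} → rank q ≡ suc r → rank s ≤ r → q ≢ s
    fresh e s≤r refl = 1+n≰n (subst (_≤ r) e s≤r)
    shift : ∀ t s → 2 * t + s + 2 ≡ 2 * t + suc (suc s)
    shift = solve-∀

  record Playing (t : ℕ) (p : Pt k) (W B : List (Pt k)) : Set where
    field
      moves     : length W ≡ t
      last-move : last W ≡ just p
      chain     : Linked _≺_ W
      below     : All (λ x → rank x ≤ rank p) W
      ledger    : Budget t (rank p) B
  open Playing

  Advance : ℕ → Pt k → List (Pt k) → Pt k → Set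
  Advance t p B q = p ≺ q × Budget (suc t) (rank q) B

  Playing-walker : ∀ {t p q W B} → Playing t p W B → Advance t p B q → Playing (suc t) q (W ∷ʳ q) B
  Playing-walker {p = p} {q} {W} pl (p≺q , bud) = record
    { moves     = trans (length-∷ʳ W) (cong suc (moves pl))
    ; last-move = last-∷ʳ W
    ; chain     = Linked.++⁺ (chain pl) (subst (λ l → Connected _≺_ l (just q)) (sym (last-move pl)) (just p≺q)) [-]
    ; below     = All.++⁺ (All.map (λ x≤p → ≤-trans x≤p (<⇒≤ (≺⇒rank< p≺q))) (below pl)) (≤-refl ∷ [])
    ; ledger    = bud
    }

  Playing-blocker : ∀ {t p W B x} → Playing t p W B → Playing t p W (B ∷ʳ x)
  Playing-blocker pl = record
    { moves = moves pl ; last-move = last-move pl ; chain = chain pl ; below = below pl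
    ; ledger = Budget-∷ʳ (ledger pl)
    }

  Playing-opening : ∀ {q} → rank q ≡ 0 → Playing 1 q (q ∷ []) []
  Playing-opening r≡0 = record
    { moves     = refl
    ; last-move = refl
    ; chain     = [-]
    ; below     = ≤-refl ∷ []
    ; ledger    = budget [] [] [] [] (subst (λ r → 2 * r + 2 ≤ 2) (sym r≡0) ≤-refl)
    }

  module Search {t p h} (pl : Playing t p (evens h) (odds h)) (ht : 3 * t + 1 ≤ 2 * k) where

    blocker-owns : ∀ {x} → x ∈ h → rank p < rank x → x ∈ odds h
    blocker-owns {x} x∈h p<x with ∈-evens-or-odds h x∈h
    ... | inj₁ x∈W = ⊥-elim (<⇒≱ p<x (All.lookup (below pl) x∈W))
    ... | inj₂ x∈B = x∈B

    odds≤t : length (odds h) ≤ t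
    odds≤t = ≤-trans (length-odds≤length-evens h) (≤-reflexive (moves pl))

    search : ∀ i n → i + n ≡ k → Budget t (rank p + i) (odds h) →
             Picks (Advance t p (odds h)) (pickFrom (upCandidates p i n) h)
    search i zero i+0≡k bud = ⊥-elim (<⇒≱ (level-below-k bud odds≤t ht) (begin
      k                   ≡⟨ trans (sym i+0≡k) (+-identityʳ i) ⟩
      i                   ≤⟨ m≤n+m i (rank p) ⟩
      rank p + i          ≤⟨ n≤1+n _ ⟩
      suc (rank p + i)    ∎))
      where open ≤-Reasoning
    search i (suc n) e bud with suc (rank p + i) <? k
    ... | no ¬level = ⊥-elim (¬level (level-below-k bud odds≤t ht))
    ... | yes level with raiseᵃ p i level ∈? h
    ...   | no _ = picks (≺-raiseᵃ p i level , Budget-advance (raiseᵃ p i level) bud (rank-raiseᵃ (a p) (b p) i))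
    ...   | yes q₁∈h with raiseᵇ p i level ∈? h
    ...     | no _ = picks (≺-raiseᵇ p i level , Budget-advance (raiseᵇ p i level) bud (rank-raiseᵇ (a p) (b p) i))
    ...     | yes q₂∈h = search (suc i) n (trans (sym (+-suc i n)) e)
                (subst (λ r → Budget t r (odds h)) (sym (+-suc (rank p) i))
                  (Budget-skip (raiseᵃ p i level) (raiseᵇ p i level) bud (rank-raiseᵃ (a p) (b p) i) (rank-raiseᵇ (a p) (b p) i) (raiseᵃ≢raiseᵇ p i level)
                     (blocker-owns q₁∈h (above (rank-raiseᵃ (a p) (b p) i)))
                     (blocker-owns q₂∈h (above (rank-raiseᵇ (a p) (b p) i)))))
      where
      above : ∀ {r} → r ≡ suc (rank p + i) → rank p < r
      above refl = s≤s (m≤m+n (rank p) i)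

  walker-advances : ∀ {t p h} → Playing t p (evens h) (odds h) → 3 * t + 1 ≤ 2 * k →
                    Picks (Advance t p (odds h)) (walker h)
  walker-advances {t} {p} {h} pl ht = subst (Picks (Advance t p (odds h))) (sym (walker-continues (last-move pl)))
    (Search.search pl ht 0 k refl (subst (λ r → Budget t r (odds h)) (sym (+-identityʳ (rank p))) (ledger pl)))

  ChainPrefix : List (Pt k) → Set
  ChainPrefix W = ceil2k/3 k ≤ length W × Linked _≺_ (take (ceil2k/3 k) W)

  ChainPrefix-++ : ∀ {W} zs → ChainPrefix W → ChainPrefix (W ++ zs)
  ChainPrefix-++ {W} zs (m≤ , linked) =
    ≤-trans m≤ (length-++-≤ˡ W) , subst (Linked _≺_) (sym (take-++-≤ _ W m≤)) linked

  data WalkerInv : List (Pt k) → Set where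
    opening  : WalkerInv []
    playing  : ∀ {h t p} → Playing t p (evens h) (odds h) → suc t ≤ ceil2k/3 k → WalkerInv h
    finished : ∀ {h} → ChainPrefix (evens h) → WalkerInv h

  WalkerInv-moved : ∀ {h t q} → Playing (suc t) q (evens h) (odds h) → suc t ≤ ceil2k/3 k → WalkerInv h
  WalkerInv-moved {h} {t} pl t<m with suc (suc t) ≤? ceil2k/3 k
  ... | yes t+1<m = playing pl t+1<m
  ... | no t+1≮m  = finished (≤-trans (≤-pred (≰⇒> t+1≮m)) (≤-reflexive (sym (moves pl))) ,
                              subst (Linked _≺_) (sym (take-all _ (evens h) length≤m)) (chain pl))
    where
    length≤m : length (evens h) ≤ ceil2k/3 k
    length≤m = ≤-trans (≤-reflexive (moves pl)) t<m

  finished-∷ʳ : ∀ {h x} → ChainPrefix (evens h) → WalkerInv (h ∷ʳ x)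
  finished-∷ʳ {h} {x} won with evens-++ h (x ∷ [])
  ... | zs , e = finished (subst ChainPrefix (sym e) (ChainPrefix-++ zs won))

  module _ (k≥1 : 1 ≤ k) (sB : Strategy k) where

    WalkerInv-step : ∀ {h x x∉h} → mover walker sB h ≡ inj₁ (x , x∉h) → WalkerInv h → WalkerInv (h ∷ʳ x)
    WalkerInv-step moved opening =
      WalkerInv-moved (Playing-opening (Picks-≡ (walker-opens k≥1) moved)) (≤-ceil2k/3 k three≤)
      where
      three≤ : 3 ≤ 2 * k + 2
      three≤ = ≤-trans (n≤1+n 3) (+-monoˡ-≤ 2 (*-monoʳ-≤ 2 k≥1))
    WalkerInv-step {h} moved (playing pl t<m) with even (length h) in parity
    ... | true  = WalkerInv-moved
      (subst₂ (Playing _ _) (sym (evens-∷ʳ-even h parity)) (sym (odds-∷ʳ-even h parity))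
        (Playing-walker pl (Picks-≡ (walker-advances pl (<-ceil2k/3⇒ k t<m)) moved)))
      t<m
    ... | false = playing
      (subst₂ (Playing _ _) (sym (evens-∷ʳ-odd h parity)) (sym (odds-∷ʳ-odd h parity)) (Playing-blocker pl))
      t<m
    WalkerInv-step _ (finished won) = finished-∷ʳ won

    WalkerInv-finished : ∀ {h} → WalkerInv h → length h ≡ k * k + k + 0 ⊎ (∀ x → x ∈ h) →
                         ChainPrefix (evens h)
    WalkerInv-finished (finished won) _ = won
    WalkerInv-finished opening (inj₂ all∈) = ⊥-elim (Picks⇒incomplete (walker-opens k≥1) all∈)
    WalkerInv-finished opening (inj₁ len) =
      ⊥-elim (<-irrefl len (≤-trans k≥1 (≤-trans (m≤n+m k (k * k)) (m≤m+n _ 0))))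
    WalkerInv-finished (playing pl t<m) (inj₂ all∈) =
      ⊥-elim (Picks⇒incomplete (walker-advances pl (<-ceil2k/3⇒ k t<m)) all∈)
    WalkerInv-finished {h} (playing {t = t} pl t<m) (inj₁ len) = ⊥-elim (<-irrefl len (begin-strict
      length h                                 ≡⟨ length-evens-odds h ⟩
      length (evens h) + length (odds h)       ≤⟨ +-monoʳ-≤ (length (evens h)) (length-odds≤length-evens h) ⟩
      length (evens h) + length (evens h)      ≡⟨ cong₂ _+_ (moves pl) (moves pl) ⟩
      t + t                                    ≤⟨ +-monoʳ-≤ t (m≤m+n t _) ⟩
      3 * t                                    <⟨ m<m+n (3 * t) (s≤s z≤n) ⟩
      3 * t + 1                                ≤⟨ <-ceil2k/3⇒ k t<m ⟩
      2 * k                                    ≡⟨ double k ⟩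
      k * 1 + k + 0                            ≤⟨ +-monoˡ-≤ 0 (+-monoˡ-≤ k (*-monoʳ-≤ k k≥1)) ⟩
      k * k + k + 0                            ∎))
      where
      open ≤-Reasoning
      double : ∀ k → 2 * k ≡ k * 1 + k + 0
      double = solve-∀

    walker-wins : BuildsChain (ceil2k/3 k) (take (ceil2k/3 k) (walkerMoves k walker sB))
    walker-wins with WalkerInv-finished (run-invariant walker sB WalkerInv WalkerInv-step (k * k + k) opening)
                                        (run-length-or-complete walker sB (k * k + k) [])
    ... | m≤ , linked = take _ W , ⊆-refl , linked , trans (length-take _ W) (m≤n⇒m⊓n≡m m≤)
      where
      W : List (Pt k)
      W = walkerMoves k walker sB

theorem5 : (k : ℕ) → 1 ≤ k →
    (Σ (Strategy k) λ sW → (sB : Strategy k) →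
       BuildsChain (ceil2k/3 k) (take (ceil2k/3 k) (walkerMoves k sW sB)))
    × (Σ (Strategy k) λ sB → (sW : Strategy k) → (c : List (Pt k)) →
       c ⊆ walkerMoves k sW sB → Linked _≺_ c → length c ≤ ceil2k/3 k)
theorem5 k k≥1 = (walker , walker-wins k≥1) , (blocker , blocker-wins)
  where open Wedge k
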